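{- Let $d\ge 1$ and $\ell\ge 3$ be integers. The number of arcs of the cyclic Kautz digraph $CK(d,\ell)$ is $$(d+1)d^{\ell}-(2d-1)\left((-1)^{\ell-1}d+d^{\ell-1}\right).$$
   Context: Let $\Sigma$ be an alphabet of $d+1$ distinct symbols. The vertices of the cyclic Kautz digraph $CK(d,\ell)$ are all words $a_1a_2\ldots a_\ell$ over $\Sigma$ with $a_i\ne a_{i+1}$ for $1\le i\le\ell-1$ and $a_1\ne a_\ell$; there is an arc from $a_1a_2\ldots a_\ell$ to $a_2\ldots a_\ell a_{\ell+1}$ whenever both words are vertices (i.e. $a_\ell\ne a_{\ell+1}$ and $a_2\ne a_{\ell+1}$). -}

module Defs where

open import Data.Nat using (ℕ; zero; suc)
open import Data.Fin using (Fin)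
open import Data.Fin.Properties using (_≟_)
open import Data.Vec using (Vec; []; _∷_; head; last; tail; init)
open import Data.List using (List; []; _∷_; map; concatMap; filter; length; cartesianProduct; allFin)
open import Data.Product using (_×_; _,_; proj₁; proj₂)
open import Relation.Nullary using (¬_; Dec; yes; no)
open import Relation.Nullary.Decidable using (_×-dec_; ¬?)
open import Relation.Binary.PropositionalEquality using (_≡_)
import Data.Vec.Properties as VP

allWords : (k n : ℕ) → List (Vec (Fin k) n)
allWords k zero = [] ∷ []
allWords k (suc n) = concatMap (λ a → map (a ∷_) (allWords k n)) (allFin k)

data NoRepeat {k : ℕ} : {n : ℕ} → Vec (Fin k) n → Set where
  nr-[] : NoRepeat []
  nr-[x] : ∀ {x} → NoRepeat (x ∷ [])
  nr-∷ : ∀ {n x y} {w : Vec (Fin k) n} →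
         ¬ (x ≡ y) → NoRepeat (y ∷ w) → NoRepeat (x ∷ y ∷ w)

noRepeat? : ∀ {k n} (w : Vec (Fin k) n) → Dec (NoRepeat w)
noRepeat? [] = yes nr-[]
noRepeat? (x ∷ []) = yes nr-[x]
noRepeat? (x ∷ y ∷ w) with x ≟ y | noRepeat? (y ∷ w)
... | yes e | _ = no λ { (nr-∷ ne _) → ne e }
... | no ne | yes r = yes (nr-∷ ne r)
... | no ne | no nr = no λ { (nr-∷ _ r) → nr r }

-- Vertex of the cyclic Kautz digraph CK(d, ℓ): words a_1…a_ℓ (ℓ ≥ 1) over an
-- alphabet of d+1 symbols with a_i ≠ a_{i+1} and a_1 ≠ a_ℓ.
IsCKVertex : (d ℓ : ℕ) → Vec (Fin (suc d)) (suc ℓ) → Set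
IsCKVertex d ℓ w = NoRepeat w × ¬ (head w ≡ last w)

isCKVertex? : ∀ d ℓ (w : Vec (Fin (suc d)) (suc ℓ)) → Dec (IsCKVertex d ℓ w)
isCKVertex? d ℓ w = noRepeat? w ×-dec ¬? (head w ≟ last w)

ckVertices : (d ℓ : ℕ) → List (Vec (Fin (suc d)) (suc ℓ))
ckVertices d ℓ = filter (isCKVertex? d ℓ) (allWords (suc d) (suc ℓ))

CKArc : (d ℓ : ℕ) → Vec (Fin (suc d)) (suc ℓ) → Vec (Fin (suc d)) (suc ℓ) → Set
CKArc d ℓ u v = tail u ≡ init v

ckArc? : ∀ d ℓ u v → Dec (CKArc d ℓ u v)
ckArc? d ℓ u v = VP.≡-dec _≟_ (tail u) (init v)

ckArcCount : (d ℓ : ℕ) → ℕ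
ckArcCount d ℓ =
  length (filter (λ p → ckArc? d ℓ (proj₁ p) (proj₂ p))
                 (cartesianProduct (ckVertices d ℓ) (ckVertices d ℓ)))

-- Cutting a vertex a·u of CK(d, ℓ) after its first letter shows that the arcs of the
-- digraph correspond to words a·u·c with u a non-repeating word of length ℓ - 1 whose
-- extensions on either side are vertices.  For fixed u both a and c range over the letters
-- different from head u and last u, so the number of arcs is the sum over non-repeating u of
-- (d - 1 + [head u = last u])².  Non-repeating words of length m + 1 = ℓ - 1 from x to y are
-- the walks of length m from x to y in the complete graph K_{d+1}; there are f_m + [x = y] (-1)^m
-- of them, where (d + 1) f_m = d^m - (-1)^m, and summing over the pairs (x, y) gives the closed form.
module Submission where

open import Defs
open import Data.Nat using (ℕ; suc; _≤_; _∸_)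
open import Data.Integer using (ℤ; +_; -_; _+_; _-_; _*_; _^_)
open import Relation.Binary.PropositionalEquality using (_≡_)

open import Data.Nat using (zero; s≤s; z≤n)
open import Data.Integer using (0ℤ; 1ℤ; -1ℤ)
import Data.Integer.Properties as ℤ
open import Data.Integer.Tactic.RingSolver using (solve-∀)
open import Data.Bool using (true; false; if_then_else_)
open import Data.List using (List; []; _∷_; _++_; map; filter; length; concatMap; cartesianProduct; allFin; tabulate)
open import Data.List.Properties using (map-tabulate; length-tabulate)
open import Data.Fin using (Fin)
import Data.Fin as Fin
open import Data.Fin.Properties using (_≟_)
open import Data.Vec using (Vec; []; _∷_; head; last; _∷ʳ_)
open import Data.Vec.Properties using (≡-dec; init-∷ʳ; last-∷ʳ)
open import Data.Product using (_×_; _,_; proj₁; proj₂)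
open import Relation.Nullary using (¬_; Dec; does; _because_; yes; no; contradiction)
open import Relation.Nullary.Decidable using (_×-dec_; ¬?)
open import Relation.Binary.PropositionalEquality using (refl; sym; trans; cong; cong₂; module ≡-Reasoning)
open import Function using (_∘_; id)

open ≡-Reasoning

private variable
  A B P Q : Set

∑ : List A → (A → ℤ) → ℤ
∑ []       f = 0ℤ
∑ (x ∷ xs) f = f x + ∑ xs f

infix 5 ∑
syntax ∑ xs (λ x → f) = ∑[ x ∈ xs ] f

∑-cong : (xs : List A) {f g : A → ℤ} → (∀ x → f x ≡ g x) → ∑ xs f ≡ ∑ xs g
∑-cong []       f≡g = refl
∑-cong (x ∷ xs) f≡g = cong₂ _+_ (f≡g x) (∑-cong xs f≡g)

∑-++ : (xs ys : List A) (f : A → ℤ) → ∑ (xs ++ ys) f ≡ ∑ xs f + ∑ ys f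
∑-++ []       ys f = sym (ℤ.+-identityˡ _)
∑-++ (x ∷ xs) ys f = trans (cong (_+_ (f x)) (∑-++ xs ys f)) (sym (ℤ.+-assoc (f x) _ _))

∑-+ : (xs : List A) (f g : A → ℤ) → ∑[ x ∈ xs ] (f x + g x) ≡ ∑ xs f + ∑ xs g
∑-+ []       f g = refl
∑-+ (x ∷ xs) f g = trans (cong (_+_ (f x + g x)) (∑-+ xs f g)) (interchange (f x) (g x) _ _)
  where
  interchange : ∀ a b c e → a + b + (c + e) ≡ a + c + (b + e)
  interchange = solve-∀

∑-- : (xs : List A) (f g : A → ℤ) → ∑[ x ∈ xs ] (f x - g x) ≡ ∑ xs f - ∑ xs g
∑-- []       f g = refl
∑-- (x ∷ xs) f g = trans (cong (_+_ (f x - g x)) (∑-- xs f g)) (interchange (f x) (g x) _ _)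
  where
  interchange : ∀ a b c e → a - b + (c - e) ≡ a + c - (b + e)
  interchange = solve-∀

∑-*ˡ : (xs : List A) (c : ℤ) (f : A → ℤ) → ∑[ x ∈ xs ] (c * f x) ≡ c * ∑ xs f
∑-*ˡ []       c f = sym (ℤ.*-zeroʳ c)
∑-*ˡ (x ∷ xs) c f = trans (cong (_+_ (c * f x)) (∑-*ˡ xs c f)) (sym (ℤ.*-distribˡ-+ c (f x) _))

∑-*ʳ : (xs : List A) (c : ℤ) (f : A → ℤ) → ∑[ x ∈ xs ] (f x * c) ≡ ∑ xs f * c
∑-*ʳ xs c f = begin
  ∑[ x ∈ xs ] (f x * c) ≡⟨ ∑-cong xs (λ x → ℤ.*-comm (f x) c) ⟩
  ∑[ x ∈ xs ] (c * f x) ≡⟨ ∑-*ˡ xs c f ⟩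
  c * ∑ xs f            ≡⟨ ℤ.*-comm c _ ⟩
  ∑ xs f * c            ∎

∑-const : (xs : List A) (c : ℤ) → ∑[ x ∈ xs ] c ≡ + length xs * c
∑-const []       c = refl
∑-const (x ∷ xs) c = begin
  c + (∑[ x ∈ xs ] c)      ≡⟨ cong (_+_ c) (∑-const xs c) ⟩
  c + + length xs * c      ≡⟨ cong (λ e → e + + length xs * c) (sym (ℤ.*-identityˡ c)) ⟩
  1ℤ * c + + length xs * c ≡⟨ sym (ℤ.*-distribʳ-+ c 1ℤ (+ length xs)) ⟩
  + suc (length xs) * c    ∎

∑-comm : (xs : List A) (ys : List B) (f : A → B → ℤ) →
         ∑[ x ∈ xs ] ∑[ y ∈ ys ] f x y ≡ ∑[ y ∈ ys ] ∑[ x ∈ xs ] f x y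
∑-comm []       ys f = trans (sym (ℤ.*-zeroʳ (+ length ys))) (sym (∑-const ys 0ℤ))
∑-comm (x ∷ xs) ys f =
  trans (cong (_+_ (∑ ys (f x))) (∑-comm xs ys f)) (sym (∑-+ ys (f x) (λ y → ∑[ x ∈ xs ] f x y)))

∑-map : (g : A → B) (xs : List A) (f : B → ℤ) → ∑ (map g xs) f ≡ ∑ xs (f ∘ g)
∑-map g []       f = refl
∑-map g (x ∷ xs) f = cong (_+_ (f (g x))) (∑-map g xs f)

∑-concatMap : (g : A → List B) (xs : List A) (f : B → ℤ) →
              ∑ (concatMap g xs) f ≡ ∑[ x ∈ xs ] ∑ (g x) f
∑-concatMap g []       f = refl
∑-concatMap g (x ∷ xs) f =
  trans (∑-++ (g x) (concatMap g xs) f) (cong (_+_ (∑ (g x) f)) (∑-concatMap g xs f))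

∑-cartesianProduct : (xs : List A) (ys : List B) (f : A × B → ℤ) →
                     ∑ (cartesianProduct xs ys) f ≡ ∑[ x ∈ xs ] ∑[ y ∈ ys ] f (x , y)
∑-cartesianProduct []       ys f = refl
∑-cartesianProduct (x ∷ xs) ys f =
  trans (∑-++ (map (x ,_) ys) _ f)
        (cong₂ _+_ (∑-map (x ,_) ys f) (∑-cartesianProduct xs ys f))

∑-tabulate : ∀ {n} (g : Fin n → A) (f : A → ℤ) → ∑ (tabulate g) f ≡ ∑ (allFin n) (f ∘ g)
∑-tabulate g f = trans (cong (λ xs → ∑ xs f) (sym (map-tabulate id g))) (∑-map g (allFin _) f)

𝟙 : Dec P → ℤ
𝟙 p = if does p then 1ℤ else 0ℤ

𝟙-cong : (P → Q) → (Q → P) → (p : Dec P) (q : Dec Q) → 𝟙 p ≡ 𝟙 q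
𝟙-cong P→Q Q→P (true  because _) (true  because _) = refl
𝟙-cong P→Q Q→P (false because _) (false because _) = refl
𝟙-cong P→Q Q→P (yes p) (no ¬q) = contradiction (P→Q p) ¬q
𝟙-cong P→Q Q→P (no ¬p) (yes q) = contradiction (Q→P q) ¬p

𝟙-× : (p : Dec P) (q : Dec Q) → 𝟙 (p ×-dec q) ≡ 𝟙 p * 𝟙 q
𝟙-× (true  because _) (true  because _) = refl
𝟙-× (true  because _) (false because _) = refl
𝟙-× (false because _) _                 = refl

𝟙-¬ : (p : Dec P) → 𝟙 (¬? p) ≡ 1ℤ - 𝟙 p
𝟙-¬ (true  because _) = refl
𝟙-¬ (false because _) = refl

𝟙-idem : (p : Dec P) → 𝟙 p * 𝟙 p ≡ 𝟙 p
𝟙-idem (true  because _) = refl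
𝟙-idem (false because _) = refl

𝟙-affine : (φ : ℤ → ℤ) (p : Dec P) → φ (𝟙 p) ≡ φ 0ℤ + 𝟙 p * (φ 1ℤ - φ 0ℤ)
𝟙-affine φ (true  because _) = affine (φ 0ℤ) (φ 1ℤ)
  where
  affine : ∀ x y → y ≡ x + 1ℤ * (y - x)
  affine = solve-∀
𝟙-affine φ (false because _) = sym (ℤ.+-identityʳ (φ 0ℤ))

𝟙≟-sym : ∀ {k} (a b : Fin k) → 𝟙 (a ≟ b) ≡ 𝟙 (b ≟ a)
𝟙≟-sym a b = 𝟙-cong sym sym (a ≟ b) (b ≟ a)

∑-filter : (xs : List A) {R : A → Set} (R? : ∀ x → Dec (R x)) (f : A → ℤ) →
           ∑ (filter R? xs) f ≡ ∑[ x ∈ xs ] 𝟙 (R? x) * f x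
∑-filter []       R? f = refl
∑-filter (x ∷ xs) R? f with does (R? x)
... | true  = cong₂ _+_ (sym (ℤ.*-identityˡ (f x))) (∑-filter xs R? f)
... | false = trans (∑-filter xs R? f) (sym (ℤ.+-identityˡ _))

length-filter : (xs : List A) {R : A → Set} (R? : ∀ x → Dec (R x)) →
                + length (filter R? xs) ≡ ∑[ x ∈ xs ] 𝟙 (R? x)
length-filter []       R? = refl
length-filter (x ∷ xs) R? with does (R? x)
... | true  = cong (_+_ 1ℤ) (length-filter xs R?)
... | false = trans (length-filter xs R?) (sym (ℤ.+-identityˡ _))

∑-allFin-suc : ∀ {k} (h : Fin (suc k) → ℤ) → ∑ (allFin (suc k)) h ≡ h Fin.zero + (∑[ b ∈ allFin k ] h (Fin.suc b))
∑-allFin-suc h = cong (_+_ (h Fin.zero)) (∑-tabulate Fin.suc h)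

∑-δ : ∀ {k} (a : Fin k) (h : Fin k → ℤ) → ∑[ b ∈ allFin k ] 𝟙 (a ≟ b) * h b ≡ h a
∑-δ {suc k} Fin.zero h = begin
  ∑[ b ∈ allFin (suc k) ] 𝟙 (Fin.zero ≟ b) * h b    ≡⟨ ∑-allFin-suc (λ b → 𝟙 (Fin.zero ≟ b) * h b) ⟩
  1ℤ * h Fin.zero + (∑[ b ∈ allFin k ] 0ℤ)          ≡⟨ cong₂ _+_ (ℤ.*-identityˡ (h Fin.zero)) (∑-const (allFin k) 0ℤ) ⟩
  h Fin.zero + + length (allFin k) * 0ℤ              ≡⟨ cong (_+_ (h Fin.zero)) (ℤ.*-zeroʳ (+ length (allFin k))) ⟩
  h Fin.zero + 0ℤ                                    ≡⟨ ℤ.+-identityʳ (h Fin.zero) ⟩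
  h Fin.zero                                         ∎
∑-δ {suc k} (Fin.suc a) h = begin
  ∑[ b ∈ allFin (suc k) ] 𝟙 (Fin.suc a ≟ b) * h b    ≡⟨ ∑-allFin-suc (λ b → 𝟙 (Fin.suc a ≟ b) * h b) ⟩
  0ℤ + (∑[ b ∈ allFin k ] 𝟙 (a ≟ b) * h (Fin.suc b)) ≡⟨ ℤ.+-identityˡ (∑[ b ∈ allFin k ] 𝟙 (a ≟ b) * h (Fin.suc b)) ⟩
  ∑[ b ∈ allFin k ] 𝟙 (a ≟ b) * h (Fin.suc b)        ≡⟨ ∑-δ a (h ∘ Fin.suc) ⟩
  h (Fin.suc a)                                       ∎

∑-allFin-const : ∀ k (c : ℤ) → ∑[ b ∈ allFin k ] c ≡ + k * c
∑-allFin-const k c = trans (∑-const (allFin k) c) (cong (λ n → + n * c) (length-tabulate {n = k} id))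

∑-≢ : ∀ {k} (a : Fin k) (h : Fin k → ℤ) →
      ∑[ b ∈ allFin k ] 𝟙 (¬? (a ≟ b)) * h b ≡ ∑ (allFin k) h - h a
∑-≢ {k} a h = begin
  ∑[ b ∈ allFin k ] 𝟙 (¬? (a ≟ b)) * h b             ≡⟨ ∑-cong (allFin k) complement ⟩
  ∑[ b ∈ allFin k ] (h b - 𝟙 (a ≟ b) * h b)          ≡⟨ ∑-- (allFin k) h _ ⟩
  ∑ (allFin k) h - (∑[ b ∈ allFin k ] 𝟙 (a ≟ b) * h b) ≡⟨ cong (_-_ (∑ (allFin k) h)) (∑-δ a h) ⟩
  ∑ (allFin k) h - h a                                ∎
  where
  distrib : ∀ i x → (1ℤ - i) * x ≡ x - i * x
  distrib = solve-∀
  complement : ∀ b → 𝟙 (¬? (a ≟ b)) * h b ≡ h b - 𝟙 (a ≟ b) * h b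
  complement b = trans (cong (_* h b) (𝟙-¬ (a ≟ b))) (distrib (𝟙 (a ≟ b)) (h b))

∑-affine-δ : ∀ {k} (a : Fin k) (x y : ℤ) → ∑[ b ∈ allFin k ] (x + 𝟙 (a ≟ b) * y) ≡ + k * x + y
∑-affine-δ {k} a x y = begin
  ∑[ b ∈ allFin k ] (x + 𝟙 (a ≟ b) * y)                 ≡⟨ ∑-+ (allFin k) _ _ ⟩
  (∑[ b ∈ allFin k ] x) + (∑[ b ∈ allFin k ] 𝟙 (a ≟ b) * y) ≡⟨ cong₂ _+_ (∑-allFin-const k x) (∑-δ a (λ _ → y)) ⟩
  + k * x + y                                             ∎

∑-diagonal : ∀ k (x y : ℤ) →
             ∑[ a ∈ allFin k ] ∑[ b ∈ allFin k ] (x + 𝟙 (a ≟ b) * y) ≡ + k * (+ k * x + y)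
∑-diagonal k x y = trans (∑-cong (allFin k) (λ a → ∑-affine-δ a x y)) (∑-allFin-const k _)

∑-allWords-∷ : ∀ k n (f : Vec (Fin k) (suc n) → ℤ) →
               ∑ (allWords k (suc n)) f ≡ ∑[ a ∈ allFin k ] ∑[ w ∈ allWords k n ] f (a ∷ w)
∑-allWords-∷ k n f = trans (∑-concatMap _ (allFin k) f)
                           (∑-cong (allFin k) (λ a → ∑-map (a ∷_) (allWords k n) f))

∑-allWords-∷ʳ : ∀ k n (f : Vec (Fin k) (suc n) → ℤ) →
                ∑ (allWords k (suc n)) f ≡ ∑[ w ∈ allWords k n ] ∑[ c ∈ allFin k ] f (w ∷ʳ c)
∑-allWords-∷ʳ k zero f = begin
  ∑ (allWords k 1) f                       ≡⟨ ∑-allWords-∷ k zero f ⟩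
  ∑[ a ∈ allFin k ] (f (a ∷ []) + 0ℤ)      ≡⟨ ∑-cong (allFin k) (λ a → ℤ.+-identityʳ (f (a ∷ []))) ⟩
  ∑[ a ∈ allFin k ] f (a ∷ [])             ≡⟨ sym (ℤ.+-identityʳ _) ⟩
  (∑[ a ∈ allFin k ] f (a ∷ [])) + 0ℤ      ∎
∑-allWords-∷ʳ k (suc n) f = begin
  ∑ (allWords k (suc (suc n))) f
    ≡⟨ ∑-allWords-∷ k (suc n) f ⟩
  ∑[ a ∈ allFin k ] ∑[ w ∈ allWords k (suc n) ] f (a ∷ w)
    ≡⟨ ∑-cong (allFin k) (λ a → ∑-allWords-∷ʳ k n (λ w → f (a ∷ w))) ⟩
  ∑[ a ∈ allFin k ] ∑[ w ∈ allWords k n ] ∑[ c ∈ allFin k ] f (a ∷ (w ∷ʳ c))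
    ≡⟨ sym (∑-allWords-∷ k n _) ⟩
  ∑[ w ∈ allWords k (suc n) ] ∑[ c ∈ allFin k ] f (w ∷ʳ c)
    ∎

∑-δ-words : ∀ k n (t : Vec (Fin k) n) (g : Vec (Fin k) n → ℤ) →
            ∑[ w ∈ allWords k n ] 𝟙 (≡-dec _≟_ t w) * g w ≡ g t
∑-δ-words k zero    []      g = trans (ℤ.+-identityʳ (1ℤ * g [])) (ℤ.*-identityˡ (g []))
∑-δ-words k (suc n) (a ∷ t) g = begin
  ∑[ w ∈ allWords k (suc n) ] 𝟙 (≡-dec _≟_ (a ∷ t) w) * g w
    ≡⟨ ∑-allWords-∷ k n _ ⟩
  ∑[ b ∈ allFin k ] ∑[ w ∈ allWords k n ] 𝟙 (≡-dec _≟_ (a ∷ t) (b ∷ w)) * g (b ∷ w)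
    ≡⟨ ∑-cong (allFin k) (λ b → ∑-cong (allWords k n) (λ w → split b w)) ⟩
  ∑[ b ∈ allFin k ] ∑[ w ∈ allWords k n ] 𝟙 (a ≟ b) * (𝟙 (≡-dec _≟_ t w) * g (b ∷ w))
    ≡⟨ ∑-cong (allFin k) (λ b → ∑-*ˡ (allWords k n) (𝟙 (a ≟ b)) _) ⟩
  ∑[ b ∈ allFin k ] 𝟙 (a ≟ b) * (∑[ w ∈ allWords k n ] 𝟙 (≡-dec _≟_ t w) * g (b ∷ w))
    ≡⟨ ∑-cong (allFin k) (λ b → cong (_*_ (𝟙 (a ≟ b))) (∑-δ-words k n t (λ w → g (b ∷ w)))) ⟩
  ∑[ b ∈ allFin k ] 𝟙 (a ≟ b) * g (b ∷ t)
    ≡⟨ ∑-δ a (λ b → g (b ∷ t)) ⟩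
  g (a ∷ t)
    ∎
  where
  split : ∀ b w → 𝟙 (≡-dec _≟_ (a ∷ t) (b ∷ w)) * g (b ∷ w) ≡ 𝟙 (a ≟ b) * (𝟙 (≡-dec _≟_ t w) * g (b ∷ w))
  split b w = trans (cong (_* g (b ∷ w)) (𝟙-× (a ≟ b) (≡-dec _≟_ t w))) (ℤ.*-assoc (𝟙 (a ≟ b)) _ _)

noRepeat-∷ʳ⁻ : ∀ {k n} (w : Vec (Fin k) (suc n)) c → NoRepeat (w ∷ʳ c) → NoRepeat w × ¬ last w ≡ c
noRepeat-∷ʳ⁻ (x ∷ [])    c (nr-∷ x≢c _) = nr-[x] , x≢c
noRepeat-∷ʳ⁻ (x ∷ y ∷ w) c (nr-∷ x≢y nr) =
  let nr′ , last≢c = noRepeat-∷ʳ⁻ (y ∷ w) c nr in nr-∷ x≢y nr′ , last≢c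

noRepeat-∷ʳ⁺ : ∀ {k n} (w : Vec (Fin k) (suc n)) c → NoRepeat w → ¬ last w ≡ c → NoRepeat (w ∷ʳ c)
noRepeat-∷ʳ⁺ (x ∷ [])    c _              x≢c    = nr-∷ x≢c nr-[x]
noRepeat-∷ʳ⁺ (x ∷ y ∷ w) c (nr-∷ x≢y nr) last≢c = nr-∷ x≢y (noRepeat-∷ʳ⁺ (y ∷ w) c nr last≢c)

𝟙-×-× : ∀ {R : Set} (p : Dec P) (q : Dec Q) (r : Dec R) → 𝟙 (p ×-dec (q ×-dec r)) ≡ 𝟙 p * (𝟙 q * 𝟙 r)
𝟙-×-× p q r = trans (𝟙-× p (q ×-dec r)) (cong (_*_ (𝟙 p)) (𝟙-× q r))

𝟙-noRepeat-∷ : ∀ {k n} (a b : Fin k) (w : Vec (Fin k) n) →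
               𝟙 (noRepeat? (a ∷ b ∷ w)) ≡ 𝟙 (¬? (a ≟ b)) * 𝟙 (noRepeat? (b ∷ w))
𝟙-noRepeat-∷ a b w =
  trans (𝟙-cong (λ { (nr-∷ a≢b nr) → a≢b , nr }) (λ (a≢b , nr) → nr-∷ a≢b nr)
                (noRepeat? (a ∷ b ∷ w)) (¬? (a ≟ b) ×-dec noRepeat? (b ∷ w)))
        (𝟙-× (¬? (a ≟ b)) (noRepeat? (b ∷ w)))

𝟙-isCKVertex-∷ : ∀ d m (a : Fin (suc d)) (u : Vec (Fin (suc d)) (suc m)) →
                 𝟙 (isCKVertex? d (suc m) (a ∷ u))
                   ≡ 𝟙 (noRepeat? u) * (𝟙 (¬? (head u ≟ a)) * 𝟙 (¬? (last u ≟ a)))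
𝟙-isCKVertex-∷ d m a u@(x ∷ _) =
  trans (𝟙-cong to from (isCKVertex? d (suc m) (a ∷ u)) (noRepeat? u ×-dec (¬? (x ≟ a) ×-dec ¬? (last u ≟ a))))
        (𝟙-×-× (noRepeat? u) (¬? (x ≟ a)) (¬? (last u ≟ a)))
  where
  to : IsCKVertex d (suc m) (a ∷ u) → NoRepeat u × ¬ x ≡ a × ¬ last u ≡ a
  to (nr-∷ a≢x nr , a≢last) = nr , a≢x ∘ sym , a≢last ∘ sym
  from : NoRepeat u × ¬ x ≡ a × ¬ last u ≡ a → IsCKVertex d (suc m) (a ∷ u)
  from (nr , x≢a , last≢a) = nr-∷ (x≢a ∘ sym) nr , last≢a ∘ sym

𝟙-isCKVertex-∷ʳ : ∀ d m (u : Vec (Fin (suc d)) (suc m)) (c : Fin (suc d)) →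
                  𝟙 (isCKVertex? d (suc m) (u ∷ʳ c))
                    ≡ 𝟙 (noRepeat? u) * (𝟙 (¬? (head u ≟ c)) * 𝟙 (¬? (last u ≟ c)))
𝟙-isCKVertex-∷ʳ d m u@(x ∷ _) c =
  trans (𝟙-cong to from (isCKVertex? d (suc m) (u ∷ʳ c)) (noRepeat? u ×-dec (¬? (x ≟ c) ×-dec ¬? (last u ≟ c))))
        (𝟙-×-× (noRepeat? u) (¬? (x ≟ c)) (¬? (last u ≟ c)))
  where
  to : IsCKVertex d (suc m) (u ∷ʳ c) → NoRepeat u × ¬ x ≡ c × ¬ last u ≡ c
  to (nr , x≢last) =
    let nr′ , last≢c = noRepeat-∷ʳ⁻ u c nr in nr′ , (λ x≡c → x≢last (trans x≡c (sym (last-∷ʳ c u)))) , last≢c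
  from : NoRepeat u × ¬ x ≡ c × ¬ last u ≡ c → IsCKVertex d (suc m) (u ∷ʳ c)
  from (nr , x≢c , last≢c) = noRepeat-∷ʳ⁺ u c nr last≢c , λ x≡last → x≢c (trans x≡last (last-∷ʳ c u))

freeLetters : ∀ {k} → Fin k → Fin k → ℤ
freeLetters {k} x y = ∑[ c ∈ allFin k ] 𝟙 (¬? (x ≟ c)) * 𝟙 (¬? (y ≟ c))

freeLetters-value : ∀ {d} (x y : Fin (suc d)) → freeLetters x y ≡ + d - 1ℤ + 𝟙 (x ≟ y)
freeLetters-value {d} x y = begin
  freeLetters x y                                             ≡⟨ ∑-≢ x (λ c → 𝟙 (¬? (y ≟ c))) ⟩
  (∑[ c ∈ allFin (suc d) ] 𝟙 (¬? (y ≟ c))) - 𝟙 (¬? (y ≟ x)) ≡⟨ cong₂ _-_ others (𝟙-¬ (y ≟ x)) ⟩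
  + suc d * 1ℤ - 1ℤ - (1ℤ - 𝟙 (y ≟ x))                        ≡⟨ cong (λ i → + suc d * 1ℤ - 1ℤ - (1ℤ - i)) (𝟙≟-sym y x) ⟩
  + suc d * 1ℤ - 1ℤ - (1ℤ - 𝟙 (x ≟ y))                        ≡⟨ simplify (+ d) (𝟙 (x ≟ y)) ⟩
  + d - 1ℤ + 𝟙 (x ≟ y)                                        ∎
  where
  others : ∑[ c ∈ allFin (suc d) ] 𝟙 (¬? (y ≟ c)) ≡ + suc d * 1ℤ - 1ℤ
  others = begin
    ∑[ c ∈ allFin (suc d) ] 𝟙 (¬? (y ≟ c))        ≡⟨ ∑-cong (allFin (suc d)) (λ c → sym (ℤ.*-identityʳ (𝟙 (¬? (y ≟ c))))) ⟩
    ∑[ c ∈ allFin (suc d) ] 𝟙 (¬? (y ≟ c)) * 1ℤ   ≡⟨ ∑-≢ y (λ _ → 1ℤ) ⟩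
    (∑[ c ∈ allFin (suc d) ] 1ℤ) - 1ℤ             ≡⟨ cong (_- 1ℤ) (∑-allFin-const (suc d) 1ℤ) ⟩
    + suc d * 1ℤ - 1ℤ                             ∎
  simplify : ∀ D i → (1ℤ + D) * 1ℤ - 1ℤ - (1ℤ - i) ≡ D - 1ℤ + i
  simplify = solve-∀

-- crossWalks d m counts the walks of length m between two distinct vertices of the complete
-- graph K_{d+1}; between a vertex and itself there are crossWalks d m + (-1)^m of them.
crossWalks : ℕ → ℕ → ℤ
crossWalks d zero    = 0ℤ
crossWalks d (suc m) = + d * crossWalks d m + -1ℤ ^ m

walks : ∀ {d} → ℕ → Fin (suc d) → Fin (suc d) → ℤ
walks {d} m a b = crossWalks d m + 𝟙 (a ≟ b) * -1ℤ ^ m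

crossWalks-closedForm : ∀ d m → + suc d * crossWalks d m ≡ (+ d) ^ m - -1ℤ ^ m
crossWalks-closedForm d zero    = ℤ.*-zeroʳ (+ suc d)
crossWalks-closedForm d (suc m) = begin
  + suc d * (+ d * f + s)             ≡⟨ regroup (+ d) f s ⟩
  + d * (+ suc d * f) + + suc d * s   ≡⟨ cong (λ e → + d * e + + suc d * s) (crossWalks-closedForm d m) ⟩
  + d * ((+ d) ^ m - s) + + suc d * s ≡⟨ collect (+ d) ((+ d) ^ m) s ⟩
  + d * (+ d) ^ m - -1ℤ * s           ∎
  where
  f = crossWalks d m
  s = -1ℤ ^ m
  regroup : ∀ D f s → (1ℤ + D) * (D * f + s) ≡ D * ((1ℤ + D) * f) + (1ℤ + D) * s
  regroup = solve-∀
  collect : ∀ D X s → D * (X - s) + (1ℤ + D) * s ≡ D * X - -1ℤ * s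
  collect = solve-∀

walks-suc : ∀ {d} m (a b : Fin (suc d)) →
            ∑[ c ∈ allFin (suc d) ] 𝟙 (¬? (a ≟ c)) * walks m c b ≡ walks (suc m) a b
walks-suc {d} m a b = begin
  ∑[ c ∈ allFin (suc d) ] 𝟙 (¬? (a ≟ c)) * walks m c b   ≡⟨ ∑-≢ a (λ c → walks m c b) ⟩
  (∑[ c ∈ allFin (suc d) ] walks m c b) - walks m a b     ≡⟨ cong (_- walks m a b) column ⟩
  + suc d * f + s - (f + 𝟙 (a ≟ b) * s)                  ≡⟨ step (+ d) f s (𝟙 (a ≟ b)) ⟩
  + d * f + s + 𝟙 (a ≟ b) * (-1ℤ * s)                    ∎
  where
  f = crossWalks d m
  s = -1ℤ ^ m
  column : ∑[ c ∈ allFin (suc d) ] walks m c b ≡ + suc d * f + s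
  column = trans (∑-cong (allFin (suc d)) (λ c → cong (λ i → f + i * s) (𝟙≟-sym c b))) (∑-affine-δ b f s)
  step : ∀ D f s i → (1ℤ + D) * f + s - (f + i * s) ≡ D * f + s + i * (-1ℤ * s)
  step = solve-∀

∑-nonRepeating : ∀ d m (a : Fin (suc d)) (ψ : Fin (suc d) → ℤ) →
                 ∑[ w ∈ allWords (suc d) m ] 𝟙 (noRepeat? (a ∷ w)) * ψ (last (a ∷ w))
                   ≡ ∑[ b ∈ allFin (suc d) ] walks m a b * ψ b
∑-nonRepeating d zero a ψ = begin
  1ℤ * ψ a + 0ℤ                                    ≡⟨ ℤ.+-identityʳ (1ℤ * ψ a) ⟩
  1ℤ * ψ a                                         ≡⟨ ℤ.*-identityˡ (ψ a) ⟩
  ψ a                                              ≡⟨ sym (∑-δ a ψ) ⟩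
  ∑[ b ∈ allFin (suc d) ] 𝟙 (a ≟ b) * ψ b          ≡⟨ ∑-cong (allFin (suc d)) (λ b → unit (𝟙 (a ≟ b)) (ψ b)) ⟩
  ∑[ b ∈ allFin (suc d) ] walks zero a b * ψ b     ∎
  where
  unit : ∀ i y → i * y ≡ (0ℤ + i * 1ℤ) * y
  unit = solve-∀
∑-nonRepeating d (suc m) a ψ = begin
  ∑[ w ∈ allWords k (suc m) ] 𝟙 (noRepeat? (a ∷ w)) * ψ (last (a ∷ w))
    ≡⟨ ∑-allWords-∷ k m _ ⟩
  ∑[ c ∈ F ] ∑[ w ∈ allWords k m ] 𝟙 (noRepeat? (a ∷ c ∷ w)) * ψ (last (c ∷ w))
    ≡⟨ ∑-cong F (λ c → trans (∑-cong (allWords k m) (λ w → firstStep c w)) (∑-*ˡ (allWords k m) (𝟙 (¬? (a ≟ c))) (λ w → 𝟙 (noRepeat? (c ∷ w)) * ψ (last (c ∷ w))))) ⟩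
  ∑[ c ∈ F ] 𝟙 (¬? (a ≟ c)) * (∑[ w ∈ allWords k m ] 𝟙 (noRepeat? (c ∷ w)) * ψ (last (c ∷ w)))
    ≡⟨ ∑-cong F (λ c → cong (_*_ (𝟙 (¬? (a ≟ c)))) (∑-nonRepeating d m c ψ)) ⟩
  ∑[ c ∈ F ] 𝟙 (¬? (a ≟ c)) * (∑[ b ∈ F ] walks m c b * ψ b)
    ≡⟨ ∑-cong F (λ c → sym (∑-*ˡ F (𝟙 (¬? (a ≟ c))) (λ b → walks m c b * ψ b))) ⟩
  ∑[ c ∈ F ] ∑[ b ∈ F ] 𝟙 (¬? (a ≟ c)) * (walks m c b * ψ b)
    ≡⟨ ∑-comm F F (λ c b → 𝟙 (¬? (a ≟ c)) * (walks m c b * ψ b)) ⟩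
  ∑[ b ∈ F ] ∑[ c ∈ F ] 𝟙 (¬? (a ≟ c)) * (walks m c b * ψ b)
    ≡⟨ ∑-cong F (λ b → trans (∑-cong F (λ c → sym (ℤ.*-assoc (𝟙 (¬? (a ≟ c))) (walks m c b) (ψ b)))) (∑-*ʳ F (ψ b) (λ c → 𝟙 (¬? (a ≟ c)) * walks m c b))) ⟩
  ∑[ b ∈ F ] (∑[ c ∈ F ] 𝟙 (¬? (a ≟ c)) * walks m c b) * ψ b
    ≡⟨ ∑-cong F (λ b → cong (_* ψ b) (walks-suc m a b)) ⟩
  ∑[ b ∈ F ] walks (suc m) a b * ψ b
    ∎
  where
  k = suc d
  F = allFin k
  firstStep : ∀ c (w : Vec (Fin k) m) →
              𝟙 (noRepeat? (a ∷ c ∷ w)) * ψ (last (c ∷ w))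
                ≡ 𝟙 (¬? (a ≟ c)) * (𝟙 (noRepeat? (c ∷ w)) * ψ (last (c ∷ w)))
  firstStep c w = trans (cong (_* ψ (last (c ∷ w))) (𝟙-noRepeat-∷ a c w)) (ℤ.*-assoc (𝟙 (¬? (a ≟ c))) _ _)

leftExtensions rightExtensions : ∀ d m → Vec (Fin (suc d)) (suc m) → ℤ
leftExtensions  d m u = ∑[ a ∈ allFin (suc d) ] 𝟙 (isCKVertex? d (suc m) (a ∷ u))
rightExtensions d m u = ∑[ c ∈ allFin (suc d) ] 𝟙 (isCKVertex? d (suc m) (u ∷ʳ c))

leftExtensions-value : ∀ d m (u : Vec (Fin (suc d)) (suc m)) →
                       leftExtensions d m u ≡ 𝟙 (noRepeat? u) * freeLetters (head u) (last u)
leftExtensions-value d m u =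
  trans (∑-cong (allFin (suc d)) (λ a → 𝟙-isCKVertex-∷ d m a u))
        (∑-*ˡ (allFin (suc d)) (𝟙 (noRepeat? u)) (λ a → 𝟙 (¬? (head u ≟ a)) * 𝟙 (¬? (last u ≟ a))))

rightExtensions-value : ∀ d m (u : Vec (Fin (suc d)) (suc m)) →
                        rightExtensions d m u ≡ 𝟙 (noRepeat? u) * freeLetters (head u) (last u)
rightExtensions-value d m u =
  trans (∑-cong (allFin (suc d)) (𝟙-isCKVertex-∷ʳ d m u))
        (∑-*ˡ (allFin (suc d)) (𝟙 (noRepeat? u)) (λ c → 𝟙 (¬? (head u ≟ c)) * 𝟙 (¬? (last u ≟ c))))

outDegree : ∀ d m (a : Fin (suc d)) (u : Vec (Fin (suc d)) (suc m)) →
            ∑[ v ∈ ckVertices d (suc m) ] 𝟙 (ckArc? d (suc m) (a ∷ u) v) ≡ rightExtensions d m u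
outDegree d m a u = begin
  ∑[ v ∈ ckVertices d (suc m) ] 𝟙 (ckArc? d (suc m) (a ∷ u) v)
    ≡⟨ ∑-filter (allWords k (suc (suc m))) (isCKVertex? d (suc m)) (𝟙 ∘ ckArc? d (suc m) (a ∷ u)) ⟩
  ∑[ v ∈ allWords k (suc (suc m)) ] 𝟙 (isCKVertex? d (suc m) v) * 𝟙 (ckArc? d (suc m) (a ∷ u) v)
    ≡⟨ ∑-allWords-∷ʳ k (suc m) (λ v → 𝟙 (isCKVertex? d (suc m) v) * 𝟙 (ckArc? d (suc m) (a ∷ u) v)) ⟩
  ∑[ v ∈ W ] ∑[ c ∈ F ] 𝟙 (isCKVertex? d (suc m) (v ∷ʳ c)) * 𝟙 (ckArc? d (suc m) (a ∷ u) (v ∷ʳ c))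
    ≡⟨ ∑-cong W (λ v → ∑-cong F (λ c → cong (_*_ (𝟙 (isCKVertex? d (suc m) (v ∷ʳ c)))) (arc⇔overlap v c))) ⟩
  ∑[ v ∈ W ] ∑[ c ∈ F ] 𝟙 (isCKVertex? d (suc m) (v ∷ʳ c)) * 𝟙 (≡-dec _≟_ u v)
    ≡⟨ ∑-cong W (λ v → trans (∑-*ʳ F (𝟙 (≡-dec _≟_ u v)) (λ c → 𝟙 (isCKVertex? d (suc m) (v ∷ʳ c)))) (ℤ.*-comm (rightExtensions d m v) _)) ⟩
  ∑[ v ∈ W ] 𝟙 (≡-dec _≟_ u v) * rightExtensions d m v
    ≡⟨ ∑-δ-words k (suc m) u (rightExtensions d m) ⟩
  rightExtensions d m u
    ∎
  where
  k = suc d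
  F = allFin k
  W = allWords k (suc m)
  arc⇔overlap : ∀ v c → 𝟙 (ckArc? d (suc m) (a ∷ u) (v ∷ʳ c)) ≡ 𝟙 (≡-dec _≟_ u v)
  arc⇔overlap v c = 𝟙-cong (λ e → trans e (init-∷ʳ c v)) (λ e → trans e (sym (init-∷ʳ c v)))
                             (ckArc? d (suc m) (a ∷ u) (v ∷ʳ c)) (≡-dec _≟_ u v)

ckArcCount-∑ : ∀ d m → + ckArcCount d (suc m)
               ≡ ∑[ u ∈ allWords (suc d) (suc m) ]
                   𝟙 (noRepeat? u) * (freeLetters (head u) (last u) * freeLetters (head u) (last u))
ckArcCount-∑ d m = begin
  + ckArcCount d (suc m)
    ≡⟨ length-filter (cartesianProduct V V) _ ⟩
  ∑[ p ∈ cartesianProduct V V ] 𝟙 (ckArc? d (suc m) (proj₁ p) (proj₂ p))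
    ≡⟨ ∑-cartesianProduct V V _ ⟩
  ∑[ u ∈ V ] ∑[ v ∈ V ] 𝟙 (ckArc? d (suc m) u v)
    ≡⟨ ∑-filter (allWords k (suc (suc m))) (isCKVertex? d (suc m)) _ ⟩
  ∑[ u ∈ allWords k (suc (suc m)) ] 𝟙 (isCKVertex? d (suc m) u) * (∑[ v ∈ V ] 𝟙 (ckArc? d (suc m) u v))
    ≡⟨ ∑-allWords-∷ k (suc m) _ ⟩
  ∑[ a ∈ F ] ∑[ u ∈ W ] 𝟙 (isCKVertex? d (suc m) (a ∷ u)) * (∑[ v ∈ V ] 𝟙 (ckArc? d (suc m) (a ∷ u) v))
    ≡⟨ ∑-cong F (λ a → ∑-cong W (λ u → cong (_*_ (𝟙 (isCKVertex? d (suc m) (a ∷ u)))) (outDegree d m a u))) ⟩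
  ∑[ a ∈ F ] ∑[ u ∈ W ] 𝟙 (isCKVertex? d (suc m) (a ∷ u)) * rightExtensions d m u
    ≡⟨ ∑-comm F W _ ⟩
  ∑[ u ∈ W ] ∑[ a ∈ F ] 𝟙 (isCKVertex? d (suc m) (a ∷ u)) * rightExtensions d m u
    ≡⟨ ∑-cong W (λ u → ∑-*ʳ F (rightExtensions d m u) (λ a → 𝟙 (isCKVertex? d (suc m) (a ∷ u)))) ⟩
  ∑[ u ∈ W ] leftExtensions d m u * rightExtensions d m u
    ≡⟨ ∑-cong W extensions ⟩
  ∑[ u ∈ W ] 𝟙 (noRepeat? u) * (freeLetters (head u) (last u) * freeLetters (head u) (last u))
    ∎
  where
  k = suc d
  F = allFin k
  W = allWords k (suc m)
  V = ckVertices d (suc m)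
  interchange : ∀ i g → i * g * (i * g) ≡ i * i * (g * g)
  interchange = solve-∀
  extensions : ∀ u → leftExtensions d m u * rightExtensions d m u
                     ≡ 𝟙 (noRepeat? u) * (freeLetters (head u) (last u) * freeLetters (head u) (last u))
  extensions u = begin
    leftExtensions d m u * rightExtensions d m u
      ≡⟨ cong₂ _*_ (leftExtensions-value d m u) (rightExtensions-value d m u) ⟩
    𝟙 (noRepeat? u) * G * (𝟙 (noRepeat? u) * G)
      ≡⟨ interchange (𝟙 (noRepeat? u)) G ⟩
    𝟙 (noRepeat? u) * 𝟙 (noRepeat? u) * (G * G)
      ≡⟨ cong (_* (G * G)) (𝟙-idem (noRepeat? u)) ⟩
    𝟙 (noRepeat? u) * (G * G)
      ∎
    where G = freeLetters (head u) (last u)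

arcCount-identity : ∀ D F S X → (1ℤ + D) * F ≡ X - S →
  let φ : ℤ → ℤ
      φ i = (F + i * S) * ((D - 1ℤ + i) * (D - 1ℤ + i))
  in (1ℤ + D) * ((1ℤ + D) * φ 0ℤ + (φ 1ℤ - φ 0ℤ))
       ≡ (1ℤ + D) * (D * (D * X)) - (+ 2 * D - 1ℤ) * (-1ℤ * S * D + D * X)
arcCount-identity D F S X closedForm = begin
  _ ≡⟨ expand D F S ⟩
  (1ℤ + D) * F * (D * ((D - 1ℤ) * (D - 1ℤ)) + D * D) + (1ℤ + D) * S * (D * D)
    ≡⟨ cong (λ e → e * (D * ((D - 1ℤ) * (D - 1ℤ)) + D * D) + (1ℤ + D) * S * (D * D)) closedForm ⟩
  (X - S) * (D * ((D - 1ℤ) * (D - 1ℤ)) + D * D) + (1ℤ + D) * S * (D * D)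
    ≡⟨ collect D S X ⟩
  _ ∎
  where
  expand : ∀ D F S → let φ : ℤ → ℤ
                         φ i = (F + i * S) * ((D - 1ℤ + i) * (D - 1ℤ + i))
                     in (1ℤ + D) * ((1ℤ + D) * φ 0ℤ + (φ 1ℤ - φ 0ℤ))
                          ≡ (1ℤ + D) * F * (D * ((D - 1ℤ) * (D - 1ℤ)) + D * D) + (1ℤ + D) * S * (D * D)
  expand = solve-∀
  collect : ∀ D S X → (X - S) * (D * ((D - 1ℤ) * (D - 1ℤ)) + D * D) + (1ℤ + D) * S * (D * D)
                      ≡ (1ℤ + D) * (D * (D * X)) - (+ 2 * D - 1ℤ) * (-1ℤ * S * D + D * X)
  collect = solve-∀

ckArcCount-closedForm : ∀ d m → + ckArcCount d (suc m)
           ≡ (+ suc d) * (+ d) ^ suc (suc m) - (+ 2 * + d - 1ℤ) * (-1ℤ ^ suc m * + d + (+ d) ^ suc m)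
ckArcCount-closedForm d m = begin
  + ckArcCount d (suc m)
    ≡⟨ ckArcCount-∑ d m ⟩
  ∑[ u ∈ allWords k (suc m) ] 𝟙 (noRepeat? u) * (freeLetters (head u) (last u) * freeLetters (head u) (last u))
    ≡⟨ ∑-allWords-∷ k m _ ⟩
  ∑[ a ∈ F ] ∑[ w ∈ allWords k m ] 𝟙 (noRepeat? (a ∷ w)) * (freeLetters a (last (a ∷ w)) * freeLetters a (last (a ∷ w)))
    ≡⟨ ∑-cong F (λ a → ∑-nonRepeating d m a (λ b → freeLetters a b * freeLetters a b)) ⟩
  ∑[ a ∈ F ] ∑[ b ∈ F ] walks m a b * (freeLetters a b * freeLetters a b)
    ≡⟨ ∑-cong F (λ a → ∑-cong F (summand a)) ⟩
  ∑[ a ∈ F ] ∑[ b ∈ F ] (φ 0ℤ + 𝟙 (a ≟ b) * (φ 1ℤ - φ 0ℤ))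
    ≡⟨ ∑-diagonal k (φ 0ℤ) (φ 1ℤ - φ 0ℤ) ⟩
  + k * (+ k * φ 0ℤ + (φ 1ℤ - φ 0ℤ))
    ≡⟨ arcCount-identity (+ d) f s ((+ d) ^ m) (crossWalks-closedForm d m) ⟩
  (+ suc d) * (+ d) ^ suc (suc m) - (+ 2 * + d - 1ℤ) * (-1ℤ ^ suc m * + d + (+ d) ^ suc m)
    ∎
  where
  k = suc d
  F = allFin k
  f = crossWalks d m
  s = -1ℤ ^ m
  φ : ℤ → ℤ
  φ i = (f + i * s) * ((+ d - 1ℤ + i) * (+ d - 1ℤ + i))
  summand : ∀ a b → walks m a b * (freeLetters a b * freeLetters a b) ≡ φ 0ℤ + 𝟙 (a ≟ b) * (φ 1ℤ - φ 0ℤ)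
  summand a b = trans (cong (λ g → walks m a b * (g * g)) (freeLetters-value a b)) (𝟙-affine φ (a ≟ b))

-- The closed form holds for every d and every ℓ ≥ 2.
proposition2 : (d ℓ : ℕ) → 1 ≤ d → 3 ≤ ℓ →
    + ckArcCount d (ℓ ∸ 1)
      ≡ (+ (suc d)) * (+ d) ^ ℓ
        - (+ (2 Data.Nat.* d) - + 1) * ((- + 1) ^ (ℓ ∸ 1) * + d + (+ d) ^ (ℓ ∸ 1))
proposition2 d (suc (suc (suc j))) _ (s≤s (s≤s (s≤s z≤n))) =
  trans (ckArcCount-closedForm d (suc j))
        (cong (λ t → (+ suc d) * (+ d) ^ suc (suc (suc j)) - (t - 1ℤ) * (-1ℤ ^ suc (suc j) * + d + (+ d) ^ suc (suc j)))
              (sym (ℤ.pos-* 2 d)))
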